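{- Let $f(X)\in\mathbb{F}_q[X]$ be an irreducible polynomial coprime to $X$ with order $m$, and let $c_{m/q}(\gamma)$ be the $q$-cyclotomic coset modulo $m$ defining $f$, i.e. $f=a\prod_{\eta\in c_{m/q}(\gamma)}(X-\zeta_m^{\eta})$ with $a\in\mathbb{F}_q^\ast$. Let $d_f=\gcd(m,q-1)$. Then the minimal binomial multiple of $f$ is $X^{\frac m{d_f}}-\zeta_m^{\frac{\gamma m}{d_f}}$. In particular, the minimal binomial order of $f$ is $\frac m{d_f}$.
   Context: $\mathrm{ord}(f)$ is the least positive $m$ with $f\mid X^m-1$. $\{\zeta_n:\gcd(n,q)=1\}$ is a fixed compatible family of primitive roots of unity ($\zeta_n^{n/k}=\zeta_k$ for $k\mid n$). $c_{m/q}(\gamma)=\{\gamma,\gamma q,\gamma q^2,\dots\}\subseteq\mathbb{Z}/m\mathbb{Z}$. A binomial is $X^n-\lambda$ with $n\ge1$, $\lambda\in\mathbb{F}_q^\ast$; the minimal binomial multiple of $f$ is the monic binomial over $\mathbb{F}_q$ of least degree divisible by $f$, its degree being the minimal binomial order. -}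

module Defs where

open import Level using (Level; _⊔_)
open import Algebra.Bundles using (CommutativeRing)
open import Algebra.Morphism.Structures using (module RingMorphisms)
open import Data.Nat as ℕ using (ℕ; zero; suc; _≤_; _<_; _%_)
import Data.Nat.Properties as ℕP
open import Data.Fin using (Fin)
open import Data.List using (List; []; _∷_; map; replicate; _++_; foldr)
open import Data.List.Membership.Propositional using (_∈_)
open import Data.List.Relation.Unary.Unique.Propositional using (Unique)
open import Data.Product using (Σ; ∃; _×_; _,_)
open import Data.Sum using (_⊎_)
open import Relation.Nullary using (¬_)
open import Relation.Binary.PropositionalEquality using (_≡_)

module _ {c ℓ : Level} (R : CommutativeRing c ℓ) where
  open CommutativeRing R

  record IsField : Set (c ⊔ ℓ) where
    field
      1≉0     : ¬ (1# ≈ 0#)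
      inverse : ∀ x → ¬ (x ≈ 0#) → ∃ λ y → x * y ≈ 1#

  HasCardinality : ℕ → Set (c ⊔ ℓ)
  HasCardinality q =
    Σ (Fin q → Carrier) λ e →
      (∀ i j → e i ≈ e j → i ≡ j) × (∀ x → ∃ λ i → e i ≈ x)

  pow : Carrier → ℕ → Carrier
  pow x zero    = 1#
  pow x (suc n) = x * pow x n

  IsPrimitiveRoot : ℕ → Carrier → Set ℓ
  IsPrimitiveRoot m ζ =
    (1 ≤ m) × (pow ζ m ≈ 1#) × (∀ k → 1 ≤ k → k < m → ¬ (pow ζ k ≈ 1#))

-- Polynomials over a commutative ring: coefficient lists, lowest degree
-- first; equality is coefficientwise (so trailing zeros are irrelevant).

  Poly : Set c
  Poly = List Carrier

  coeff : Poly → ℕ → Carrier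
  coeff []      _       = 0#
  coeff (a ∷ p) zero    = a
  coeff (a ∷ p) (suc i) = coeff p i

  infix 4 _≈ₚ_
  _≈ₚ_ : Poly → Poly → Set ℓ
  p ≈ₚ r = ∀ i → coeff p i ≈ coeff r i

  infixl 6 _+ₚ_
  _+ₚ_ : Poly → Poly → Poly
  []      +ₚ r       = r
  (a ∷ p) +ₚ []      = a ∷ p
  (a ∷ p) +ₚ (b ∷ r) = (a + b) ∷ (p +ₚ r)

  infixl 7 _*ₚ_
  _*ₚ_ : Poly → Poly → Poly
  []      *ₚ r = []
  (a ∷ p) *ₚ r = map (a *_) r +ₚ (0# ∷ (p *ₚ r))

  const : Carrier → Poly
  const a = a ∷ []

  monomial : ℕ → Poly
  monomial n = replicate n 0# ++ (1# ∷ [])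

  linear : Carrier → Poly
  linear a = (- a) ∷ 1# ∷ []

  binomial : ℕ → Carrier → Poly
  binomial n λ′ = monomial n +ₚ const (- λ′)

  prodₚ : List Poly → Poly
  prodₚ = foldr _*ₚ_ (const 1#)

  infix 4 _∣ₚ_
  _∣ₚ_ : Poly → Poly → Set (c ⊔ ℓ)
  f ∣ₚ g = ∃ λ h → f *ₚ h ≈ₚ g

  HasDegree : Poly → ℕ → Set ℓ
  HasDegree p n = ¬ (coeff p n ≈ 0#) × (∀ i → n < i → coeff p i ≈ 0#)

  -- units of F[X] for a field F: the nonzero constants
  IsUnitₚ : Poly → Set ℓ
  IsUnitₚ p = HasDegree p 0

  Irreducible : Poly → Set (c ⊔ ℓ)
  Irreducible f =
    (∃ λ n → 1 ≤ n × HasDegree f n) ×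
    (∀ g h → f ≈ₚ g *ₚ h → IsUnitₚ g ⊎ IsUnitₚ h)

  Coprime : Poly → Poly → Set (c ⊔ ℓ)
  Coprime f g = ∀ h → h ∣ₚ f → h ∣ₚ g → IsUnitₚ h

  X : Poly
  X = monomial 1

  HasOrder : Poly → ℕ → Set (c ⊔ ℓ)
  HasOrder f m =
    1 ≤ m × f ∣ₚ binomial m 1# ×
    (∀ k → 1 ≤ k → f ∣ₚ binomial k 1# → m ≤ k)

  IsMinimalBinomialMultiple : Poly → ℕ → Carrier → Set (c ⊔ ℓ)
  IsMinimalBinomialMultiple f n λ′ =
    1 ≤ n × ¬ (λ′ ≈ 0#) × f ∣ₚ binomial n λ′ ×
    (∀ n′ μ → 1 ≤ n′ → ¬ (μ ≈ 0#) → f ∣ₚ binomial n′ μ → n ≤ n′)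

module _ {c₁ ℓ₁ c₂ ℓ₂ : Level}
         (F : CommutativeRing c₁ ℓ₁) (K : CommutativeRing c₂ ℓ₂) where
  private
    module F = CommutativeRing F
    module K = CommutativeRing K

  IsRingHom : (F.Carrier → K.Carrier) → Set (c₁ ⊔ ℓ₁ ⊔ ℓ₂)
  IsRingHom = RingMorphisms.IsRingHomomorphism F.rawRing K.rawRing

  mapPoly : (F.Carrier → K.Carrier) → Poly F → Poly K
  mapPoly ι = map ι

-- q-cyclotomic coset c_{m/q}(γ) = {γ, γq, γq², …} ⊆ ℤ/mℤ,
-- elements represented by their residues η ∈ [0, m):
-- η ∈ c_{m/q}(γ) iff η ≡ γ q^i (mod m) for some i

InCyclotomicCoset : (m q γ η : ℕ) → Set
InCyclotomicCoset m q γ η =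
  η < m × ∃ λ i → ∃ λ k → γ ℕ.* q ℕ.^ i ≡ η ℕ.+ k ℕ.* m

-- Over K, f = a ∏ (X - ζ^η) with η running over the coset, and these roots are distinct.
-- Hence f ∣ Xᵏ - λ as soon as every root r has rᵏ = ι λ: the remainder of Xᵏ modulo f has
-- degree below deg f and agrees with ι λ at deg f distinct points, so it is the constant λ.
-- Let d = gcd(m, q - 1) and n = m / d. Every root is ζ^(γ qʲ), and ζ^(γ n) is fixed by x ↦ x^q
-- because m ∣ n (q - 1); so every root has n-th power ζ^(γ n), giving f ∣ Xⁿ - μ.
-- Conversely, if f ∣ Xⁿ′ - μ′ then ι μ′ = (ζ^γ)ⁿ′ = (ζ^(γ q))ⁿ′ = (ι μ′)^q, so every root r has
-- r^(n′ (q - 1)) = 1. Then f ∣ Xᵗ - 1 for t = n′ (q - 1) mod m < m = ord f, forcing t = 0;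
-- thus m ∣ n′ (q - 1), i.e. n ∣ n′.

module Submission where

open import Defs
open import Level using (_⊔_)
open import Algebra.Bundles using (CommutativeRing)
open import Algebra.Morphism.Structures using (module RingMorphisms)
import Data.Fin as Fin
open import Data.Nat as ℕ using (ℕ; zero; suc; _≤_; _<_; _∸_; z≤n; s≤s; NonZero; _%_; _/_)
import Data.Nat.Properties as ℕ
open import Data.Nat.Coprimality as Coprimality using (coprime-/gcd; coprime-divisor)
open import Data.Nat.DivMod using (m≡m%n+[m/n]*n; m%n<n; m*n/n≡m)
open import Data.Nat.Divisibility
  using (_∣_; divides; quotient; m%n≡0⇒n∣m; *-monoʳ-∣; *-cancelʳ-∣; ∣n⇒∣m*n; ∣⇒≤)
open import Data.Nat.GCD using (gcd; gcd[m,n]∣n; gcd[m,n]≢0)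
open import Data.List using (List; []; _∷_; map; length; drop)
open import Data.List.Properties using (map-cong; map-∘)
open import Data.List.Membership.Propositional using (_∈_)
open import Data.List.Membership.Propositional.Properties using (∈-map⁺; ∈-map⁻; ∈-length)
open import Data.List.Relation.Unary.Any using (here; there)
open import Data.List.Relation.Unary.All as All using (All; []; _∷_)
open import Data.List.Relation.Unary.All.Properties using () renaming (map⁺ to All-map⁺)
open import Data.List.Relation.Unary.AllPairs using (AllPairs; []; _∷_)
open import Data.List.Relation.Unary.Unique.Propositional using (Unique)
open import Data.Product using (∃; ∃₂; _×_; _,_; proj₁; proj₂)
open import Data.Sum using (inj₁; inj₂)
open import Function using (_∘_)
open import Relation.Binary.Definitions using (Decidable; tri<; tri≈; tri>)
open import Relation.Binary.PropositionalEquality as ≡ using (_≡_)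
open import Relation.Nullary using (¬_; yes; no; contradiction)

module Power {c ℓ} (R : CommutativeRing c ℓ) where
  open CommutativeRing R hiding (zero)
  open import Algebra.Properties.Semiring.Exp semiring public
    using (_^_; ^-congˡ; ^-homo-*; ^-assocʳ)
  open import Relation.Binary.Reasoning.Setoid setoid

  pow≡^ : ∀ x n → pow R x n ≡ x ^ n
  pow≡^ x zero    = ≡.refl
  pow≡^ x (suc n) = ≡.cong (x *_) (pow≡^ x n)

  ^-multiple≈1 : ∀ {x m} → x ^ m ≈ 1# → ∀ t → x ^ (t ℕ.* m) ≈ 1#
  ^-multiple≈1         xᵐ≈1 zero    = refl
  ^-multiple≈1 {x} {m} xᵐ≈1 (suc t) = begin
    x ^ (m ℕ.+ t ℕ.* m)     ≈⟨ ^-homo-* x m (t ℕ.* m) ⟩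
    x ^ m * x ^ (t ℕ.* m)   ≈⟨ *-cong xᵐ≈1 (^-multiple≈1 xᵐ≈1 t) ⟩
    1# * 1#                 ≈⟨ *-identityˡ 1# ⟩
    1#                      ∎

  ^-periodic : ∀ {x m} → x ^ m ≈ 1# → ∀ a t → x ^ (a ℕ.+ t ℕ.* m) ≈ x ^ a
  ^-periodic {x} {m} xᵐ≈1 a t = begin
    x ^ (a ℕ.+ t ℕ.* m)   ≈⟨ ^-homo-* x a (t ℕ.* m) ⟩
    x ^ a * x ^ (t ℕ.* m) ≈⟨ *-congˡ (^-multiple≈1 xᵐ≈1 t) ⟩
    x ^ a * 1#            ≈⟨ *-identityʳ _ ⟩
    x ^ a                 ∎

  ^-iterate-fixed : ∀ {x q} → x ^ q ≈ x → ∀ j → x ^ (q ℕ.^ j) ≈ x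
  ^-iterate-fixed         xᵠ≈x zero    = *-identityʳ _
  ^-iterate-fixed {x} {q} xᵠ≈x (suc j) = begin
    x ^ (q ℕ.* q ℕ.^ j)   ≈⟨ ^-assocʳ x q (q ℕ.^ j) ⟨
    (x ^ q) ^ (q ℕ.^ j)   ≈⟨ ^-congˡ (q ℕ.^ j) xᵠ≈x ⟩
    x ^ (q ℕ.^ j)         ≈⟨ ^-iterate-fixed xᵠ≈x j ⟩
    x                     ∎

module Polynomial {c ℓ} (R : CommutativeRing c ℓ) where
  open CommutativeRing R hiding (zero)
  open import Algebra.Properties.Ring ring using (-‿distribˡ-*)
  open Power R using (_^_)
  open import Algebra.Solver.Ring.NaturalCoefficients.Default commutativeSemiring
    using (solve; _:=_; _:+_; _:*_)
  open import Relation.Binary.Reasoning.Setoid setoid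

  infixl 6 _+P_
  _+P_ : Poly R → Poly R → Poly R
  _+P_ = _+ₚ_ R

  infixl 7 _*P_
  _*P_ : Poly R → Poly R → Poly R
  _*P_ = _*ₚ_ R

  infix 4 _≈P_ _∣P_
  _≈P_ : Poly R → Poly R → Set ℓ
  _≈P_ = _≈ₚ_ R

  _∣P_ : Poly R → Poly R → Set (c ⊔ ℓ)
  _∣P_ = _∣ₚ_ R

  coeff-+P : ∀ p r i → coeff R (p +P r) i ≈ coeff R p i + coeff R r i
  coeff-+P []      r       i       = sym (+-identityˡ _)
  coeff-+P (a ∷ p) []      i       = sym (+-identityʳ _)
  coeff-+P (a ∷ p) (b ∷ r) zero    = refl
  coeff-+P (a ∷ p) (b ∷ r) (suc i) = coeff-+P p r i

  coeff-map-* : ∀ a p i → coeff R (map (a *_) p) i ≈ a * coeff R p i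
  coeff-map-* a []      i       = sym (zeroʳ a)
  coeff-map-* a (b ∷ p) zero    = refl
  coeff-map-* a (b ∷ p) (suc i) = coeff-map-* a p i

  ∷-cong : ∀ {a b p r} → a ≈ b → p ≈P r → (a ∷ p) ≈P (b ∷ r)
  ∷-cong a≈b p≈r zero    = a≈b
  ∷-cong a≈b p≈r (suc i) = p≈r i

  +P-cong : ∀ p p′ r r′ → p ≈P p′ → r ≈P r′ → p +P r ≈P p′ +P r′
  +P-cong p p′ r r′ p≈p′ r≈r′ i = begin
    coeff R (p +P r) i         ≈⟨ coeff-+P p r i ⟩
    coeff R p i + coeff R r i   ≈⟨ +-cong (p≈p′ i) (r≈r′ i) ⟩
    coeff R p′ i + coeff R r′ i ≈⟨ coeff-+P p′ r′ i ⟨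
    coeff R (p′ +P r′) i       ∎

  coeff-const-0# : ∀ i → coeff R (const R 0#) i ≈ 0#
  coeff-const-0# zero    = refl
  coeff-const-0# (suc i) = refl

  coeff-∷*P : ∀ a p r i → coeff R ((a ∷ p) *P r) i ≈ a * coeff R r i + coeff R (0# ∷ (p *P r)) i
  coeff-∷*P a p r i = trans (coeff-+P (map (a *_) r) (0# ∷ (p *P r)) i) (+-congʳ (coeff-map-* a r i))

  coeff-const-*P : ∀ a p i → coeff R (const R a *P p) i ≈ a * coeff R p i
  coeff-const-*P a p i =
    trans (coeff-∷*P a [] p i) (trans (+-congˡ (coeff-const-0# i)) (+-identityʳ _))

  coeff-linear-*P : ∀ r p i → coeff R (linear R r *P p) i ≈ - r * coeff R p i + coeff R (0# ∷ p) i
  coeff-linear-*P r p i = trans (coeff-∷*P (- r) (1# ∷ []) p i) (+-congˡ (∷-cong refl 1*p≈p i))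
    where
    1*p≈p : const R 1# *P p ≈P p
    1*p≈p j = trans (coeff-const-*P 1# p j) (*-identityˡ _)

  coeff-*P-[] : ∀ p i → coeff R (p *P []) i ≈ 0#
  coeff-*P-[] []      i       = refl
  coeff-*P-[] (a ∷ p) zero    = refl
  coeff-*P-[] (a ∷ p) (suc i) = coeff-*P-[] p i

  coeff-*P-∷ : ∀ p b r i → coeff R (p *P (b ∷ r)) i ≈ b * coeff R p i + coeff R (0# ∷ (p *P r)) i
  coeff-*P-∷ []      b r i       = sym (trans (+-cong (zeroʳ b) (coeff-const-0# i)) (+-identityʳ 0#))
  coeff-*P-∷ (a ∷ p) b r zero    = +-congʳ (*-comm a b)
  coeff-*P-∷ (a ∷ p) b r (suc j) = begin
    coeff R (map (a *_) r +P (p *P (b ∷ r))) j         ≈⟨ coeff-+P (map (a *_) r) (p *P (b ∷ r)) j ⟩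
    coeff R (map (a *_) r) j + coeff R (p *P (b ∷ r)) j ≈⟨ +-cong (coeff-map-* a r j) (coeff-*P-∷ p b r j) ⟩
    a * ar + (b * bp + rest)                             ≈⟨ swap (a * ar) (b * bp) rest ⟩
    b * bp + (a * ar + rest)                             ≈⟨ +-congˡ (coeff-∷*P a p r j) ⟨
    b * bp + coeff R ((a ∷ p) *P r) j                    ∎
    where
    ar : Carrier
    ar = coeff R r j
    bp : Carrier
    bp = coeff R p j
    rest : Carrier
    rest = coeff R (0# ∷ (p *P r)) j
    swap : ∀ x y z → x + (y + z) ≈ y + (x + z)
    swap = solve 3 (λ x y z → x :+ (y :+ z) := y :+ (x :+ z)) refl

  linearProduct : List Carrier → Poly R
  linearProduct rs = prodₚ R (map (linear R) rs)

  linearProduct-degree : ∀ rs i → length rs < i → coeff R (linearProduct rs) i ≈ 0#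
  linearProduct-degree []       (suc i) _            = refl
  linearProduct-degree (r ∷ rs) (suc i) (s≤s len<i) = begin
    coeff R (linear R r *P linearProduct rs) (suc i)                   ≈⟨ coeff-linear-*P r (linearProduct rs) (suc i) ⟩
    - r * coeff R (linearProduct rs) (suc i) + coeff R (linearProduct rs) i
      ≈⟨ +-cong (*-congˡ (linearProduct-degree rs (suc i) (ℕ.m<n⇒m<1+n len<i))) (linearProduct-degree rs i len<i) ⟩
    - r * 0# + 0#                                                      ≈⟨ +-identityʳ _ ⟩
    - r * 0#                                                           ≈⟨ zeroʳ (- r) ⟩
    0#                                                                 ∎

  linearProduct-monic : ∀ rs → coeff R (linearProduct rs) (length rs) ≈ 1#
  linearProduct-monic []       = refl
  linearProduct-monic (r ∷ rs) = begin
    coeff R (linear R r *P linearProduct rs) (suc (length rs))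
      ≈⟨ coeff-linear-*P r (linearProduct rs) (suc (length rs)) ⟩
    - r * coeff R (linearProduct rs) (suc (length rs)) + coeff R (linearProduct rs) (length rs)
      ≈⟨ +-cong (*-congˡ (linearProduct-degree rs (suc (length rs)) ℕ.≤-refl)) (linearProduct-monic rs) ⟩
    - r * 0# + 1#                                               ≈⟨ +-congʳ (zeroʳ (- r)) ⟩
    0# + 1#                                                     ≈⟨ +-identityˡ 1# ⟩
    1#                                                          ∎

  eval : Poly R → Carrier → Carrier
  eval []      x = 0#
  eval (a ∷ p) x = a + x * eval p x

  eval-≈0 : ∀ p x → p ≈P [] → eval p x ≈ 0#
  eval-≈0 []      x p≈0 = refl
  eval-≈0 (a ∷ p) x p≈0 = begin
    a + x * eval p x ≈⟨ +-cong (p≈0 zero) (*-congˡ (eval-≈0 p x (p≈0 ∘ suc))) ⟩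
    0# + x * 0#      ≈⟨ +-identityˡ _ ⟩
    x * 0#           ≈⟨ zeroʳ x ⟩
    0#               ∎

  eval-cong : ∀ p r x → p ≈P r → eval p x ≈ eval r x
  eval-cong []      r       x p≈r = sym (eval-≈0 r x (sym ∘ p≈r))
  eval-cong (a ∷ p) []      x p≈r = eval-≈0 (a ∷ p) x p≈r
  eval-cong (a ∷ p) (b ∷ r) x p≈r = +-cong (p≈r zero) (*-congˡ (eval-cong p r x (p≈r ∘ suc)))

  eval-+P : ∀ p r x → eval (p +P r) x ≈ eval p x + eval r x
  eval-+P []      r       x = sym (+-identityˡ _)
  eval-+P (a ∷ p) []      x = sym (+-identityʳ _)
  eval-+P (a ∷ p) (b ∷ r) x = begin
    (a + b) + x * eval (p +P r) x         ≈⟨ +-congˡ (*-congˡ (eval-+P p r x)) ⟩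
    (a + b) + x * (eval p x + eval r x)   ≈⟨ regroup a b x (eval p x) (eval r x) ⟩
    (a + x * eval p x) + (b + x * eval r x) ∎
    where
    regroup : ∀ a b x u v → (a + b) + x * (u + v) ≈ (a + x * u) + (b + x * v)
    regroup = solve 5 (λ a b x u v → (a :+ b) :+ x :* (u :+ v) := (a :+ x :* u) :+ (b :+ x :* v)) refl

  eval-map-* : ∀ a p x → eval (map (a *_) p) x ≈ a * eval p x
  eval-map-* a []      x = sym (zeroʳ a)
  eval-map-* a (b ∷ p) x = begin
    a * b + x * eval (map (a *_) p) x ≈⟨ +-congˡ (*-congˡ (eval-map-* a p x)) ⟩
    a * b + x * (a * eval p x)         ≈⟨ regroup a b x (eval p x) ⟩
    a * (b + x * eval p x)             ∎
    where
    regroup : ∀ a b x u → a * b + x * (a * u) ≈ a * (b + x * u)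
    regroup = solve 4 (λ a b x u → a :* b :+ x :* (a :* u) := a :* (b :+ x :* u)) refl

  eval-*P : ∀ p r x → eval (p *P r) x ≈ eval p x * eval r x
  eval-*P []      r x = sym (zeroˡ _)
  eval-*P (a ∷ p) r x = begin
    eval (map (a *_) r +P (0# ∷ (p *P r))) x          ≈⟨ eval-+P (map (a *_) r) (0# ∷ (p *P r)) x ⟩
    eval (map (a *_) r) x + (0# + x * eval (p *P r) x) ≈⟨ +-cong (eval-map-* a r x) (+-identityˡ _) ⟩
    a * eval r x + x * eval (p *P r) x                 ≈⟨ +-congˡ (*-congˡ (eval-*P p r x)) ⟩
    a * eval r x + x * (eval p x * eval r x)           ≈⟨ regroup a x (eval p x) (eval r x) ⟩
    (a + x * eval p x) * eval r x                      ∎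
    where
    regroup : ∀ a x u v → a * v + x * (u * v) ≈ (a + x * u) * v
    regroup = solve 4 (λ a x u v → a :* v :+ x :* (u :* v) := (a :+ x :* u) :* v) refl

  eval-const : ∀ a x → eval (const R a) x ≈ a
  eval-const a x = trans (+-congˡ (zeroʳ x)) (+-identityʳ a)

  eval-linear : ∀ r x → eval (linear R r) x ≈ x - r
  eval-linear r x = begin
    - r + x * (1# + x * 0#) ≈⟨ +-congˡ (*-congˡ (eval-const 1# x)) ⟩
    - r + x * 1#            ≈⟨ +-congˡ (*-identityʳ x) ⟩
    - r + x                 ≈⟨ +-comm (- r) x ⟩
    x - r                   ∎

  eval-monomial : ∀ n x → eval (monomial R n) x ≈ x ^ n
  eval-monomial zero    x = eval-const 1# x
  eval-monomial (suc n) x = trans (+-identityˡ _) (*-congˡ (eval-monomial n x))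

  eval-binomial : ∀ n μ x → eval (binomial R n μ) x ≈ x ^ n - μ
  eval-binomial n μ x =
    trans (eval-+P (monomial R n) (const R (- μ)) x) (+-cong (eval-monomial n x) (eval-const (- μ) x))

  eval-linearProduct-∈ : ∀ {r rs} → r ∈ rs → eval (linearProduct rs) r ≈ 0#
  eval-linearProduct-∈ {r} {r ∷ rs} (here ≡.refl) = begin
    eval (linear R r *P linearProduct rs) r               ≈⟨ eval-*P (linear R r) (linearProduct rs) r ⟩
    eval (linear R r) r * eval (linearProduct rs) r       ≈⟨ *-congʳ (trans (eval-linear r r) (-‿inverseʳ r)) ⟩
    0# * eval (linearProduct rs) r                        ≈⟨ zeroˡ _ ⟩
    0#                                                    ∎
  eval-linearProduct-∈ {r} {s ∷ rs} (there r∈rs) = begin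
    eval (linear R s *P linearProduct rs) r               ≈⟨ eval-*P (linear R s) (linearProduct rs) r ⟩
    eval (linear R s) r * eval (linearProduct rs) r       ≈⟨ *-congˡ (eval-linearProduct-∈ r∈rs) ⟩
    eval (linear R s) r * 0#                              ≈⟨ zeroʳ _ ⟩
    0#                                                    ∎

  eval-∣P : ∀ f g x → f ∣P g → eval f x ≈ 0# → eval g x ≈ 0#
  eval-∣P f g x (h , fh≈g) fx≈0 = begin
    eval g x              ≈⟨ eval-cong (f *P h) g x fh≈g ⟨
    eval (f *P h) x       ≈⟨ eval-*P f h x ⟩
    eval f x * eval h x   ≈⟨ *-congʳ fx≈0 ⟩
    0# * eval h x         ≈⟨ zeroˡ _ ⟩
    0#                    ∎

  ∣P-respʳ : ∀ f g h → g ≈P h → f ∣P g → f ∣P h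
  ∣P-respʳ f g h g≈h (q , fq≈g) = q , λ i → trans (fq≈g i) (g≈h i)

  binomial-cong : ∀ n {μ ν} → μ ≈ ν → binomial R n μ ≈P binomial R n ν
  binomial-cong n {μ} {ν} μ≈ν = +P-cong (monomial R n) (monomial R n) (const R (- μ)) (const R (- ν))
    (λ _ → refl) (∷-cong (-‿cong μ≈ν) (λ _ → refl))

  ∣P-sub-const : ∀ f g q μ → g ≈P f *P q +P const R μ → f ∣P g +P const R (- μ)
  ∣P-sub-const f g q μ g≈ = q , λ i → sym (begin
    coeff R (g +P const R (- μ)) i                                  ≈⟨ coeff-+P g (const R (- μ)) i ⟩
    coeff R g i + coeff R (const R (- μ)) i
                                  ≈⟨ +-congʳ (trans (g≈ i) (coeff-+P (f *P q) (const R μ) i)) ⟩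
    (coeff R (f *P q) i + coeff R (const R μ) i) + coeff R (const R (- μ)) i
                                                                     ≈⟨ +-assoc _ _ _ ⟩
    coeff R (f *P q) i + (coeff R (const R μ) i + coeff R (const R (- μ)) i)
                                                                     ≈⟨ +-congˡ (cancel i) ⟩
    coeff R (f *P q) i + 0#                                          ≈⟨ +-identityʳ _ ⟩
    coeff R (f *P q) i                                               ∎)
    where
    cancel : ∀ i → coeff R (const R μ) i + coeff R (const R (- μ)) i ≈ 0#
    cancel zero    = -‿inverseʳ μ
    cancel (suc i) = +-identityʳ 0#

  -- Horner's scheme: the quotient of p by X - r
  quotientByLinear : Poly R → Carrier → Poly R
  quotientByLinear []      r = []
  quotientByLinear (a ∷ p) r = eval p r ∷ quotientByLinear p r

  coeff-quotientByLinear : ∀ p r i → coeff R (quotientByLinear p r) i ≡ eval (drop (suc i) p) r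
  coeff-quotientByLinear []      r i       = ≡.refl
  coeff-quotientByLinear (a ∷ p) r zero    = ≡.refl
  coeff-quotientByLinear (a ∷ p) r (suc i) = coeff-quotientByLinear p r i

  eval-quotientByLinear : ∀ p r s → eval p s ≈ (s - r) * eval (quotientByLinear p r) s + eval p r
  eval-quotientByLinear []      r s = sym (trans (+-identityʳ _) (zeroʳ _))
  eval-quotientByLinear (a ∷ p) r s = begin
    a + s * eval p s                                 ≈⟨ +-congˡ (*-congˡ (eval-quotientByLinear p r s)) ⟩
    a + s * ((s - r) * q + b)                        ≈⟨ +-congˡ (*-congʳ (shift s r)) ⟩
    a + ((s - r) + r) * ((s - r) * q + b)            ≈⟨ regroup a r q b (s - r) ⟩
    (s - r) * (b + ((s - r) + r) * q) + (a + r * b)  ≈⟨ +-congʳ (*-congˡ (+-congˡ (*-congʳ (shift s r)))) ⟨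
    (s - r) * (b + s * q) + (a + r * b)              ∎
    where
    q : Carrier
    q = eval (quotientByLinear p r) s
    b : Carrier
    b = eval p r
    shift : ∀ s r → s ≈ (s - r) + r
    shift s r = sym (trans (+-assoc s (- r) r) (trans (+-congˡ (-‿inverseˡ r)) (+-identityʳ s)))
    regroup : ∀ a r q b t → a + (t + r) * (t * q + b) ≈ t * (b + (t + r) * q) + (a + r * b)
    regroup = solve 5 (λ a r q b t → a :+ (t :+ r) :* (t :* q :+ b)
                                     := t :* (b :+ (t :+ r) :* q) :+ (a :+ r :* b)) refl

  eval-drop : ∀ i p r → eval (drop i p) r ≈ coeff R p i + r * eval (drop (suc i) p) r
  eval-drop zero    []      r = sym (trans (+-identityˡ _) (zeroʳ r))
  eval-drop (suc i) []      r = sym (trans (+-identityˡ _) (zeroʳ r))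
  eval-drop zero    (a ∷ p) r = refl
  eval-drop (suc i) (a ∷ p) r = eval-drop i p r

  drop-≈P[] : ∀ j p → (∀ i → j ≤ i → coeff R p i ≈ 0#) → drop j p ≈P []
  drop-≈P[] zero    p       high i = high i z≤n
  drop-≈P[] (suc j) []      high i = refl
  drop-≈P[] (suc j) (a ∷ p) high i = drop-≈P[] j p (λ k j≤k → high (suc k) (s≤s j≤k)) i

  module DivMod (f : Poly R) (k : ℕ) (v : Carrier) (lead : coeff R f k * v ≈ 1#)
                (degree : ∀ i → k < i → coeff R f i ≈ 0#) where

    divMod : ∀ g → ∃₂ λ q r → g ≈P f *P q +P r × (∀ i → k ≤ i → coeff R r i ≈ 0#)
    divMod []      = [] , [] , f*[]+[]≈[] , (λ _ _ → refl)
      where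
      f*[]+[]≈[] : [] ≈P f *P [] +P []
      f*[]+[]≈[] i = sym (trans (coeff-+P (f *P []) [] i) (trans (+-identityʳ _) (coeff-*P-[] f i)))
    divMod (b ∷ g) with divMod g
    ... | q , r , g≈ , r-small = s ∷ q , r′ , b∷g≈ , r′-small
      where
      b∷r : Poly R
      b∷r = b ∷ r
      s : Carrier
      s = coeff R b∷r k * v
      r′ : Poly R
      r′ = b∷r +P map ((- s) *_) f

      coeff-r′ : ∀ i → coeff R r′ i ≈ coeff R b∷r i - s * coeff R f i
      coeff-r′ i = trans (coeff-+P b∷r (map ((- s) *_) f) i)
                     (+-congˡ (trans (coeff-map-* (- s) f i) (sym (-‿distribˡ-* s (coeff R f i)))))

      b∷g≈ : b ∷ g ≈P f *P (s ∷ q) +P r′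
      b∷g≈ i = begin
        coeff R (b ∷ g) i                                   ≈⟨ ∷-cong (sym (+-identityˡ b)) g≈ i ⟩
        coeff R ((0# ∷ f *P q) +P b∷r) i                    ≈⟨ coeff-+P (0# ∷ f *P q) b∷r i ⟩
        coeff R (0# ∷ f *P q) i + coeff R b∷r i             ≈⟨ cancel (s * coeff R f i) _ _ ⟨
        (s * coeff R f i + coeff R (0# ∷ f *P q) i) + (coeff R b∷r i - s * coeff R f i)
                                                            ≈⟨ +-cong (coeff-*P-∷ f s q i) (coeff-r′ i) ⟨
        coeff R (f *P (s ∷ q)) i + coeff R r′ i              ≈⟨ coeff-+P (f *P (s ∷ q)) r′ i ⟨
        coeff R (f *P (s ∷ q) +P r′) i                      ∎
        where
        cancel : ∀ u x y → (u + x) + (y - u) ≈ x + y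
        cancel u x y = begin
          (u + x) + (y - u) ≈⟨ solve 4 (λ u x y w → (u :+ x) :+ (y :+ w) := (x :+ y) :+ (u :+ w)) refl u x y (- u) ⟩
          (x + y) + (u - u) ≈⟨ +-congˡ (-‿inverseʳ u) ⟩
          (x + y) + 0#      ≈⟨ +-identityʳ _ ⟩
          x + y             ∎

      r′-small : ∀ i → k ≤ i → coeff R r′ i ≈ 0#
      r′-small i k≤i with ℕ.m≤n⇒m<n∨m≡n k≤i
      ... | inj₂ ≡.refl = begin
        coeff R r′ k                          ≈⟨ coeff-r′ k ⟩
        coeff R b∷r k - s * coeff R f k        ≈⟨ +-congˡ (-‿cong s*lead) ⟩
        coeff R b∷r k - coeff R b∷r k          ≈⟨ -‿inverseʳ _ ⟩
        0#                                    ∎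
        where
        s*lead : s * coeff R f k ≈ coeff R b∷r k
        s*lead = begin
          coeff R b∷r k * v * coeff R f k   ≈⟨ *-assoc _ v _ ⟩
          coeff R b∷r k * (v * coeff R f k) ≈⟨ *-congˡ (trans (*-comm v _) lead) ⟩
          coeff R b∷r k * 1#                ≈⟨ *-identityʳ _ ⟩
          coeff R b∷r k                     ∎
      r′-small (suc j) _ | inj₁ (s≤s k≤j) = begin
        coeff R r′ (suc j)                  ≈⟨ coeff-r′ (suc j) ⟩
        coeff R r j - s * coeff R f (suc j) ≈⟨ +-cong (r-small j k≤j) (-‿cong (*-congˡ (degree (suc j) (s≤s k≤j)))) ⟩
        0# - s * 0#                         ≈⟨ +-congˡ (-‿cong (zeroʳ s)) ⟩
        0# - 0#                             ≈⟨ -‿inverseʳ 0# ⟩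
        0#                                  ∎

module FieldPolynomial {c ℓ} (R : CommutativeRing c ℓ) (isField : IsField R) where
  open CommutativeRing R hiding (zero)
  open Polynomial R
  open Power R using (_^_)
  open IsField isField
  open import Algebra.Properties.Ring ring using (x∙y⁻¹≈ε⇒x≈y)
  open import Relation.Binary.Reasoning.Setoid setoid

  *-cancelˡ : ∀ {u x y} → ¬ u ≈ 0# → u * x ≈ u * y → x ≈ y
  *-cancelˡ {u} {x} {y} u≉0 ux≈uy with inverse u u≉0
  ... | u⁻¹ , uu⁻¹≈1 = begin
    x               ≈⟨ *-identityˡ x ⟨
    1# * x          ≈⟨ *-congʳ u⁻¹u≈1 ⟨
    (u⁻¹ * u) * x   ≈⟨ *-assoc u⁻¹ u x ⟩
    u⁻¹ * (u * x)   ≈⟨ *-congˡ ux≈uy ⟩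
    u⁻¹ * (u * y)   ≈⟨ *-assoc u⁻¹ u y ⟨
    (u⁻¹ * u) * y   ≈⟨ *-congʳ u⁻¹u≈1 ⟩
    1# * y          ≈⟨ *-identityˡ y ⟩
    y               ∎
    where
    u⁻¹u≈1 : u⁻¹ * u ≈ 1#
    u⁻¹u≈1 = trans (*-comm u⁻¹ u) uu⁻¹≈1

  ^-≉0 : ∀ {x} n → ¬ x ≈ 0# → ¬ x ^ n ≈ 0#
  ^-≉0 zero    x≉0 = 1≉0
  ^-≉0 (suc n) x≉0 xxⁿ≈0 = ^-≉0 n x≉0 (*-cancelˡ x≉0 (trans xxⁿ≈0 (sym (zeroʳ _))))

  ^-suc≈⇒^≈1 : ∀ x n → ¬ x ≈ 0# → x ^ suc n ≈ x → x ^ n ≈ 1#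
  ^-suc≈⇒^≈1 x n x≉0 xxⁿ≈x = *-cancelˡ x≉0 (trans xxⁿ≈x (sym (*-identityʳ _)))

  Distinct : List Carrier → Set (c ⊔ ℓ)
  Distinct = AllPairs (λ x y → ¬ x ≈ y)

  distinct-roots⇒≈P[] : ∀ {rs} → Distinct rs → ∀ p → (∀ i → length rs ≤ i → coeff R p i ≈ 0#) →
                        All (λ r → eval p r ≈ 0#) rs → p ≈P []
  distinct-roots⇒≈P[] []                 p high []               i = high i z≤n
  distinct-roots⇒≈P[] {r ∷ rs} (r≉rs ∷ distinct) p high (pr≈0 ∷ prs≈0) i =
    sum≈0 (trans (sym (eval-drop i p r)) (drop-root i)) (trans (*-congˡ (drop-root (suc i))) (zeroʳ r))
    where
    q : Poly R
    q = quotientByLinear p r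

    sum≈0 : ∀ {x y} → x + y ≈ 0# → y ≈ 0# → x ≈ 0#
    sum≈0 {x} x+y≈0 y≈0 = trans (sym (+-identityʳ x)) (trans (+-congˡ (sym y≈0)) x+y≈0)

    q-small : ∀ i → length rs ≤ i → coeff R q i ≈ 0#
    q-small i len≤i rewrite coeff-quotientByLinear p r i =
      eval-≈0 (drop (suc i) p) r (drop-≈P[] (suc i) p (λ j i<j → high j (ℕ.≤-trans (s≤s len≤i) i<j)))

    q-root : ∀ {s} → ¬ r ≈ s → eval p s ≈ 0# → eval q s ≈ 0#
    q-root {s} r≉s ps≈0 =
      *-cancelˡ s-r≉0 (trans (sum≈0 (trans (sym (eval-quotientByLinear p r s)) ps≈0) pr≈0) (sym (zeroʳ _)))
      where
      s-r≉0 : ¬ s - r ≈ 0#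
      s-r≉0 s-r≈0 = r≉s (sym (x∙y⁻¹≈ε⇒x≈y s r s-r≈0))

    q≈0 : q ≈P []
    q≈0 = distinct-roots⇒≈P[] distinct q q-small
            (All.zipWith (λ (r≉s , ps≈0) → q-root r≉s ps≈0) (r≉rs , prs≈0))

    drop-root : ∀ i → eval (drop i p) r ≈ 0#
    drop-root zero    = pr≈0
    drop-root (suc i) = ≡.subst (_≈ 0#) (coeff-quotientByLinear p r i) (q≈0 i)

module PolynomialMap {c₁ ℓ₁ c₂ ℓ₂} (F : CommutativeRing c₁ ℓ₁) (K : CommutativeRing c₂ ℓ₂)
                     (ι : CommutativeRing.Carrier F → CommutativeRing.Carrier K) (hom : IsRingHom F K ι) where
  private
    module F = CommutativeRing F
    module K = CommutativeRing K
    module PF = Polynomial F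
    module PK = Polynomial K
  open RingMorphisms.IsRingHomomorphism hom
  open Power K using (_^_)
  open import Relation.Binary.Reasoning.Setoid K.setoid

  ιP : Poly F → Poly K
  ιP = mapPoly F K ι

  coeff-ιP : ∀ p i → coeff K (ιP p) i K.≈ ι (coeff F p i)
  coeff-ιP []      i       = K.sym 0#-homo
  coeff-ιP (a ∷ p) zero    = K.refl
  coeff-ιP (a ∷ p) (suc i) = coeff-ιP p i

  ιP-cong : ∀ p r → p PF.≈P r → ιP p PK.≈P ιP r
  ιP-cong p r p≈r i = K.trans (coeff-ιP p i) (K.trans (⟦⟧-cong (p≈r i)) (K.sym (coeff-ιP r i)))

  ιP-+P : ∀ p r → ιP (p PF.+P r) PK.≈P ιP p PK.+P ιP r
  ιP-+P p r i = begin
    coeff K (ιP (p PF.+P r)) i             ≈⟨ coeff-ιP (p PF.+P r) i ⟩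
    ι (coeff F (p PF.+P r) i)              ≈⟨ ⟦⟧-cong (PF.coeff-+P p r i) ⟩
    ι (coeff F p i F.+ coeff F r i)        ≈⟨ +-homo _ _ ⟩
    ι (coeff F p i) K.+ ι (coeff F r i)    ≈⟨ K.+-cong (coeff-ιP p i) (coeff-ιP r i) ⟨
    coeff K (ιP p) i K.+ coeff K (ιP r) i  ≈⟨ PK.coeff-+P (ιP p) (ιP r) i ⟨
    coeff K (ιP p PK.+P ιP r) i            ∎

  ιP-map-* : ∀ a p → ιP (map (a F.*_) p) PK.≈P map (ι a K.*_) (ιP p)
  ιP-map-* a []      i = K.refl
  ιP-map-* a (b ∷ p)   = PK.∷-cong (*-homo a b) (ιP-map-* a p)

  ιP-*P : ∀ p r → ιP (p PF.*P r) PK.≈P ιP p PK.*P ιP r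
  ιP-*P []      r i = K.refl
  ιP-*P (a ∷ p) r i = K.trans (ιP-+P (map (a F.*_) r) (F.0# ∷ (p PF.*P r)) i)
    (PK.+P-cong (ιP (map (a F.*_) r)) (map (ι a K.*_) (ιP r)) (ιP (F.0# ∷ (p PF.*P r))) (K.0# ∷ (ιP p PK.*P ιP r))
      (ιP-map-* a r) (PK.∷-cong 0#-homo (ιP-*P p r)) i)

  ιP-monomial : ∀ n → ιP (monomial F n) PK.≈P monomial K n
  ιP-monomial zero    = PK.∷-cong 1#-homo (λ _ → K.refl)
  ιP-monomial (suc n) = PK.∷-cong 0#-homo (ιP-monomial n)

  ιP-binomial : ∀ n μ → ιP (binomial F n μ) PK.≈P binomial K n (ι μ)
  ιP-binomial n μ i = K.trans (ιP-+P (monomial F n) (const F (F.- μ)) i)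
    (PK.+P-cong (ιP (monomial F n)) (monomial K n) (ιP (const F (F.- μ))) (const K (K.- ι μ))
      (ιP-monomial n) (PK.∷-cong (-‿homo μ) (λ _ → K.refl)) i)

  eval-ιP-monomial : ∀ n x → PK.eval (ιP (monomial F n)) x K.≈ x ^ n
  eval-ιP-monomial n x =
    K.trans (PK.eval-cong (ιP (monomial F n)) (monomial K n) x (ιP-monomial n)) (PK.eval-monomial n x)

  eval-ιP-binomial : ∀ n μ x → PK.eval (ιP (binomial F n μ)) x K.≈ x ^ n K.- ι μ
  eval-ιP-binomial n μ x =
    K.trans (PK.eval-cong (ιP (binomial F n μ)) (binomial K n (ι μ)) x (ιP-binomial n μ)) (PK.eval-binomial n (ι μ) x)

  ιP-∣P : ∀ f g → f PF.∣P g → ιP f PK.∣P ιP g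
  ιP-∣P f g (h , fh≈g) = ιP h , λ i → K.trans (K.sym (ιP-*P f h i)) (ιP-cong (f PF.*P h) g fh≈g i)

module FieldHomomorphism {c₁ ℓ₁ c₂ ℓ₂} (F : CommutativeRing c₁ ℓ₁) (isFieldF : IsField F)
                         (K : CommutativeRing c₂ ℓ₂) (isFieldK : IsField K)
                         (ι : CommutativeRing.Carrier F → CommutativeRing.Carrier K) (hom : IsRingHom F K ι) where
  private
    module F = CommutativeRing F
    module K = CommutativeRing K
  open RingMorphisms.IsRingHomomorphism hom
  open import Algebra.Properties.Ring F.ring using (x∙y⁻¹≈ε⇒x≈y)
  open import Relation.Binary.Reasoning.Setoid K.setoid

  ι-≉0 : ∀ {x} → ¬ x F.≈ F.0# → ¬ ι x K.≈ K.0#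
  ι-≉0 {x} x≉0 ιx≈0 with IsField.inverse isFieldF x x≉0
  ... | y , xy≈1 = IsField.1≉0 isFieldK (begin
    K.1#            ≈⟨ 1#-homo ⟨
    ι F.1#          ≈⟨ ⟦⟧-cong xy≈1 ⟨
    ι (x F.* y)     ≈⟨ *-homo x y ⟩
    ι x K.* ι y     ≈⟨ K.*-congʳ ιx≈0 ⟩
    K.0# K.* ι y    ≈⟨ K.zeroˡ _ ⟩
    K.0#            ∎)

  ι-reflects-0 : Decidable F._≈_ → ∀ {x} → ι x K.≈ K.0# → x F.≈ F.0#
  ι-reflects-0 _≟_ {x} ιx≈0 with x ≟ F.0#
  ... | yes x≈0 = x≈0
  ... | no  x≉0 = contradiction ιx≈0 (ι-≉0 x≉0)

  ι-injective : Decidable F._≈_ → ∀ {x y} → ι x K.≈ ι y → x F.≈ y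
  ι-injective _≟_ {x} {y} ιx≈ιy = x∙y⁻¹≈ε⇒x≈y x y (ι-reflects-0 _≟_ (begin
    ι (x F.- y)        ≈⟨ +-homo x (F.- y) ⟩
    ι x K.+ ι (F.- y)  ≈⟨ K.+-cong ιx≈ιy (-‿homo y) ⟩
    ι y K.- ι y        ≈⟨ K.-‿inverseʳ (ι y) ⟩
    K.0#               ∎))

module SplitPolynomial
  {c₁ ℓ₁ c₂ ℓ₂} (F : CommutativeRing c₁ ℓ₁) (isFieldF : IsField F) (_≟_ : Decidable (CommutativeRing._≈_ F))
  (K : CommutativeRing c₂ ℓ₂) (isFieldK : IsField K)
  (ι : CommutativeRing.Carrier F → CommutativeRing.Carrier K) (hom : IsRingHom F K ι)
  (f : Poly F) (a : CommutativeRing.Carrier F) (a≉0 : ¬ CommutativeRing._≈_ F a (CommutativeRing.0# F))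
  (rs : List (CommutativeRing.Carrier K)) (rs≢[] : 0 < length rs)
  (distinct : FieldPolynomial.Distinct K isFieldK rs)
  (split : _≈ₚ_ K (mapPoly F K ι f) (_*ₚ_ K (const K (ι a)) (Polynomial.linearProduct K rs))) where

  private
    module F = CommutativeRing F
    module K = CommutativeRing K
    module PF = Polynomial F
    module PK = Polynomial K
  open RingMorphisms.IsRingHomomorphism hom using (⟦⟧-cong; 0#-homo; 1#-homo)
  open PolynomialMap F K ι hom
  open FieldHomomorphism F isFieldF K isFieldK ι hom
  open Power K using (_^_; ^-periodic)
  open PK using (eval; linearProduct)
  open FieldPolynomial K isFieldK using (distinct-roots⇒≈P[])
  open import Algebra.Properties.Ring K.ring using (x∙y⁻¹≈ε⇒x≈y)
  open import Relation.Binary.Reasoning.Setoid K.setoid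

  ι-coeff-f : ∀ i → ι (coeff F f i) K.≈ ι a K.* coeff K (linearProduct rs) i
  ι-coeff-f i = K.trans (K.sym (coeff-ιP f i)) (K.trans (split i) (PK.coeff-const-*P (ι a) (linearProduct rs) i))

  f-degree : ∀ i → length rs < i → coeff F f i F.≈ F.0#
  f-degree i len<i = ι-reflects-0 _≟_ (K.trans (ι-coeff-f i)
    (K.trans (K.*-congˡ (PK.linearProduct-degree rs i len<i)) (K.zeroʳ _)))

  f-lead≉0 : ¬ coeff F f (length rs) F.≈ F.0#
  f-lead≉0 lead≈0 = ι-≉0 a≉0 (begin
    ι a                                            ≈⟨ K.*-identityʳ (ι a) ⟨
    ι a K.* K.1#                                   ≈⟨ K.*-congˡ (PK.linearProduct-monic rs) ⟨
    ι a K.* coeff K (linearProduct rs) (length rs)  ≈⟨ ι-coeff-f (length rs) ⟨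
    ι (coeff F f (length rs))                      ≈⟨ ⟦⟧-cong lead≈0 ⟩
    ι F.0#                                         ≈⟨ 0#-homo ⟩
    K.0#                                           ∎)

  eval-ιf-root : ∀ {r} → r ∈ rs → eval (ιP f) r K.≈ K.0#
  eval-ιf-root {r} r∈rs = begin
    eval (ιP f) r                    ≈⟨ PK.eval-cong (ιP f) (const K (ι a) PK.*P linearProduct rs) r split ⟩
    eval (const K (ι a) PK.*P linearProduct rs) r        ≈⟨ PK.eval-*P (const K (ι a)) (linearProduct rs) r ⟩
    eval (const K (ι a)) r K.* eval (linearProduct rs) r ≈⟨ K.*-congˡ (PK.eval-linearProduct-∈ r∈rs) ⟩
    eval (const K (ι a)) r K.* K.0#                     ≈⟨ K.zeroʳ _ ⟩
    K.0#                                                ∎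

  eval-ιP-multiple : ∀ g {r} → f PF.∣P g → r ∈ rs → eval (ιP g) r K.≈ K.0#
  eval-ιP-multiple g {r} f∣g r∈rs = PK.eval-∣P (ιP f) (ιP g) r (ιP-∣P f g f∣g) (eval-ιf-root r∈rs)

  eval-ιP-mod : ∀ g q rem {r} → g PF.≈P f PF.*P q PF.+P rem → r ∈ rs → eval (ιP g) r K.≈ eval (ιP rem) r
  eval-ιP-mod g q rem {r} g≈ r∈rs = begin
    eval (ιP g) r                        ≈⟨ PK.eval-cong (ιP g) (ιP (fq PF.+P rem)) r (ιP-cong g (fq PF.+P rem) g≈) ⟩
    eval (ιP (fq PF.+P rem)) r           ≈⟨ PK.eval-cong (ιP (fq PF.+P rem)) (ιP fq PK.+P ιP rem) r (ιP-+P fq rem) ⟩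
    eval (ιP fq PK.+P ιP rem) r          ≈⟨ PK.eval-+P (ιP fq) (ιP rem) r ⟩
    eval (ιP fq) r K.+ eval (ιP rem) r   ≈⟨ K.+-congʳ (eval-ιP-multiple fq (q , λ _ → F.refl) r∈rs) ⟩
    K.0# K.+ eval (ιP rem) r             ≈⟨ K.+-identityˡ _ ⟩
    eval (ιP rem) r                      ∎
    where
    fq : Poly F
    fq = f PF.*P q

  ∣binomial⇒roots^≈ : ∀ n μ → f PF.∣P binomial F n μ → ∀ {r} → r ∈ rs → r ^ n K.≈ ι μ
  ∣binomial⇒roots^≈ n μ f∣ {r} r∈rs = x∙y⁻¹≈ε⇒x≈y (r ^ n) (ι μ) (begin
    r ^ n K.- ι μ                  ≈⟨ eval-ιP-binomial n μ r ⟨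
    eval (ιP (binomial F n μ)) r   ≈⟨ eval-ιP-multiple (binomial F n μ) f∣ r∈rs ⟩
    K.0#                           ∎)

  -- ι g - c has degree below length rs and vanishes on the distinct points rs.
  constant-on-roots⇒constant : ∀ g c → (∀ i → length rs ≤ i → coeff F g i F.≈ F.0#) →
                               (∀ {r} → r ∈ rs → eval (ιP g) r K.≈ c) →
                               g PF.≈P const F (coeff F g 0) × ι (coeff F g 0) K.≈ c
  constant-on-roots⇒constant g c g-small g≈c = g≈g₀ , ιg₀≈c
    where
    D : Poly K
    D = ιP g PK.+P const K (K.- c)

    coeff-D : ∀ i → coeff K D i K.≈ coeff K (ιP g) i K.+ coeff K (const K (K.- c)) i
    coeff-D = PK.coeff-+P (ιP g) (const K (K.- c))

    D-root : ∀ {r} → r ∈ rs → eval D r K.≈ K.0#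
    D-root {r} r∈rs = begin
      eval D r                                     ≈⟨ PK.eval-+P (ιP g) (const K (K.- c)) r ⟩
      eval (ιP g) r K.+ eval (const K (K.- c)) r   ≈⟨ K.+-cong (g≈c r∈rs) (PK.eval-const (K.- c) r) ⟩
      c K.- c                                      ≈⟨ K.-‿inverseʳ c ⟩
      K.0#                                         ∎

    D-small : ∀ i → length rs ≤ i → coeff K D i K.≈ K.0#
    D-small zero    len≤0 = contradiction len≤0 (ℕ.<⇒≱ rs≢[])
    D-small (suc j) len≤i = begin
      coeff K D (suc j)                  ≈⟨ coeff-D (suc j) ⟩
      coeff K (ιP g) (suc j) K.+ K.0#    ≈⟨ K.+-identityʳ _ ⟩
      coeff K (ιP g) (suc j)             ≈⟨ coeff-ιP g (suc j) ⟩
      ι (coeff F g (suc j))              ≈⟨ ⟦⟧-cong (g-small (suc j) len≤i) ⟩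
      ι F.0#                             ≈⟨ 0#-homo ⟩
      K.0#                               ∎

    D≈0 : D PK.≈P []
    D≈0 = distinct-roots⇒≈P[] distinct D D-small (All.tabulate D-root)

    g≈g₀ : g PF.≈P const F (coeff F g 0)
    g≈g₀ zero    = F.refl
    g≈g₀ (suc j) = ι-reflects-0 _≟_ (begin
      ι (coeff F g (suc j))              ≈⟨ coeff-ιP g (suc j) ⟨
      coeff K (ιP g) (suc j)             ≈⟨ K.+-identityʳ _ ⟨
      coeff K (ιP g) (suc j) K.+ K.0#    ≈⟨ coeff-D (suc j) ⟨
      coeff K D (suc j)                  ≈⟨ D≈0 (suc j) ⟩
      K.0#                               ∎)

    ιg₀≈c : ι (coeff F g 0) K.≈ c
    ιg₀≈c = x∙y⁻¹≈ε⇒x≈y (ι (coeff F g 0)) c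
      (K.trans (K.+-congʳ (K.sym (coeff-ιP g 0))) (K.trans (K.sym (coeff-D 0)) (D≈0 0)))

  roots^≈⇒∣binomial : ∀ n c → (∀ {r} → r ∈ rs → r ^ n K.≈ c) →
                      ∃ λ μ → ι μ K.≈ c × f PF.∣P binomial F n μ
  roots^≈⇒∣binomial n c rⁿ≈c with IsField.inverse isFieldF (coeff F f (length rs)) f-lead≉0
  ... | v , lead with PF.DivMod.divMod f (length rs) v lead f-degree (monomial F n)
  ... | q , rem , xⁿ≈ , rem-small =
    coeff F rem 0 , proj₂ rem-constant , PF.∣P-sub-const f (monomial F n) q (coeff F rem 0) xⁿ≈fq+rem₀
    where
    rem-root : ∀ {r} → r ∈ rs → eval (ιP rem) r K.≈ c
    rem-root {r} r∈rs = begin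
      eval (ιP rem) r              ≈⟨ eval-ιP-mod (monomial F n) q rem xⁿ≈ r∈rs ⟨
      eval (ιP (monomial F n)) r   ≈⟨ eval-ιP-monomial n r ⟩
      r ^ n                        ≈⟨ rⁿ≈c r∈rs ⟩
      c                            ∎

    rem-constant : rem PF.≈P const F (coeff F rem 0) × ι (coeff F rem 0) K.≈ c
    rem-constant = constant-on-roots⇒constant rem c rem-small rem-root

    xⁿ≈fq+rem₀ : monomial F n PF.≈P f PF.*P q PF.+P const F (coeff F rem 0)
    xⁿ≈fq+rem₀ i = F.trans (xⁿ≈ i)
      (PF.+P-cong (f PF.*P q) (f PF.*P q) rem (const F (coeff F rem 0)) (λ _ → F.refl) (proj₁ rem-constant) i)

  roots^≈1⇒order∣ : ∀ {m k} → HasOrder F f m → (∀ {r} → r ∈ rs → r ^ k K.≈ K.1#) → m ∣ k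
  roots^≈1⇒order∣ {m} {k} (1≤m , f∣xᵐ-1 , minimal) rᵏ≈1 = m%n≡0⇒n∣m k m k%m≡0
    where
    instance
      m≢0 : NonZero m
      m≢0 = ℕ.>-nonZero 1≤m

    roots^≈1⇒∣binomial : ∀ t → (∀ {r} → r ∈ rs → r ^ t K.≈ K.1#) → f PF.∣P binomial F t F.1#
    roots^≈1⇒∣binomial t rᵗ≈1 =
      let μ , ιμ≈1 , f∣ = roots^≈⇒∣binomial t K.1# rᵗ≈1
      in  PF.∣P-respʳ f (binomial F t μ) (binomial F t F.1#)
            (PF.binomial-cong t (ι-injective _≟_ (K.trans ιμ≈1 (K.sym 1#-homo)))) f∣

    rᵏ%ᵐ≈1 : ∀ {r} → r ∈ rs → r ^ (k % m) K.≈ K.1#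
    rᵏ%ᵐ≈1 {r} r∈rs = begin
      r ^ (k % m)                      ≈⟨ ^-periodic rᵐ≈1 (k % m) (k / m) ⟨
      r ^ (k % m ℕ.+ (k / m) ℕ.* m)    ≡⟨ ≡.cong (r ^_) (m≡m%n+[m/n]*n k m) ⟨
      r ^ k                            ≈⟨ rᵏ≈1 r∈rs ⟩
      K.1#                             ∎
      where
      rᵐ≈1 : r ^ m K.≈ K.1#
      rᵐ≈1 = K.trans (∣binomial⇒roots^≈ m F.1# f∣xᵐ-1 r∈rs) 1#-homo

    below-order⇒≡0 : ∀ t → t < m → (∀ {r} → r ∈ rs → r ^ t K.≈ K.1#) → t ≡ 0
    below-order⇒≡0 zero    _   _    = ≡.refl
    below-order⇒≡0 (suc t) t<m rᵗ≈1 =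
      contradiction (minimal (suc t) (s≤s z≤n) (roots^≈1⇒∣binomial (suc t) rᵗ≈1)) (ℕ.<⇒≱ t<m)

    k%m≡0 : k % m ≡ 0
    k%m≡0 = below-order⇒≡0 (k % m) (m%n<n k m) rᵏ%ᵐ≈1

module PrimitiveRoot {c ℓ} (K : CommutativeRing c ℓ) (isField : IsField K)
                     {m : ℕ} {ζ : CommutativeRing.Carrier K} (prim : IsPrimitiveRoot K m ζ) where
  open CommutativeRing K hiding (zero)
  open Power K
  open FieldPolynomial K isField using (*-cancelˡ; ^-≉0; Distinct)
  open IsField isField using (1≉0)
  open import Relation.Binary.Reasoning.Setoid setoid

  ζᵐ≈1 : ζ ^ m ≈ 1#
  ζᵐ≈1 = ≡.subst (_≈ 1#) (pow≡^ ζ m) (proj₁ (proj₂ prim))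

  ζ^≉0 : ∀ a → ¬ ζ ^ a ≈ 0#
  ζ^≉0 a = ^-≉0 a ζ≉0
    where
    instance
      m≢0 : NonZero m
      m≢0 = ℕ.>-nonZero (proj₁ prim)
    ζ≉0 : ¬ ζ ≈ 0#
    ζ≉0 ζ≈0 = 1≉0 (begin
      1#                    ≈⟨ ζᵐ≈1 ⟨
      ζ ^ m                 ≡⟨ ≡.cong (ζ ^_) (ℕ.suc-pred m) ⟨
      ζ * ζ ^ ℕ.pred m      ≈⟨ *-congʳ ζ≈0 ⟩
      0# * ζ ^ ℕ.pred m     ≈⟨ zeroˡ _ ⟩
      0#                    ∎)

  ζ^-multiple : ∀ {k} → m ∣ k → ζ ^ k ≈ 1#
  ζ^-multiple (divides t ≡.refl) = ^-multiple≈1 ζᵐ≈1 t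

  ζ^-frobenius-fixed : ∀ k p → m ∣ k ℕ.* p → (ζ ^ k) ^ suc p ≈ ζ ^ k
  ζ^-frobenius-fixed k p m∣kp = begin
    ζ ^ k * (ζ ^ k) ^ p   ≈⟨ *-congˡ (^-assocʳ ζ k p) ⟩
    ζ ^ k * ζ ^ (k ℕ.* p) ≈⟨ *-congˡ (ζ^-multiple m∣kp) ⟩
    ζ ^ k * 1#            ≈⟨ *-identityʳ _ ⟩
    ζ ^ k                 ∎

  ζ^-injective-< : ∀ {a b} → a < b → b < m → ¬ ζ ^ a ≈ ζ ^ b
  ζ^-injective-< {a} {b} a<b b<m ζᵃ≈ζᵇ =
    proj₂ (proj₂ prim) (b ∸ a) (ℕ.m<n⇒0<n∸m a<b) (ℕ.≤-<-trans (ℕ.m∸n≤m b a) b<m)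
      (≡.subst (_≈ 1#) (≡.sym (pow≡^ ζ (b ∸ a))) ζᵇ⁻ᵃ≈1)
    where
    ζᵇ⁻ᵃ≈1 : ζ ^ (b ∸ a) ≈ 1#
    ζᵇ⁻ᵃ≈1 = *-cancelˡ (ζ^≉0 a) (begin
      ζ ^ a * ζ ^ (b ∸ a)     ≈⟨ ^-homo-* ζ a (b ∸ a) ⟨
      ζ ^ (a ℕ.+ (b ∸ a))     ≡⟨ ≡.cong (ζ ^_) (ℕ.m+[n∸m]≡n (ℕ.<⇒≤ a<b)) ⟩
      ζ ^ b                   ≈⟨ ζᵃ≈ζᵇ ⟨
      ζ ^ a                   ≈⟨ *-identityʳ _ ⟨
      ζ ^ a * 1#              ∎)

  ζ^-injective : ∀ {a b} → a < m → b < m → ζ ^ a ≈ ζ ^ b → a ≡ b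
  ζ^-injective {a} {b} a<m b<m ζᵃ≈ζᵇ with ℕ.<-cmp a b
  ... | tri< a<b _ _ = contradiction ζᵃ≈ζᵇ (ζ^-injective-< a<b b<m)
  ... | tri≈ _ a≡b _ = a≡b
  ... | tri> _ _ b<a = contradiction (sym ζᵃ≈ζᵇ) (ζ^-injective-< b<a a<m)

  distinct-powers : ∀ {L} → Unique L → All (_< m) L → Distinct (map (ζ ^_) L)
  distinct-powers []                []           = []
  distinct-powers (x∉xs ∷ unique) (x<m ∷ xs<m) =
    All-map⁺ (All.zipWith (λ (x≢y , y<m) → x≢y ∘ ζ^-injective x<m y<m) (x∉xs , xs<m))
      ∷ distinct-powers unique xs<m

module CyclotomicCoset {c ℓ} (K : CommutativeRing c ℓ) (isField : IsField K)
                       {m : ℕ} {ζ : CommutativeRing.Carrier K} (prim : IsPrimitiveRoot K m ζ)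
                       {q γ : ℕ} (γ<m : γ < m) {L : List ℕ} (unique : Unique L)
                       (coset : ∀ η → (η ∈ L → InCyclotomicCoset m q γ η) ×
                                      (InCyclotomicCoset m q γ η → η ∈ L)) where
  open CommutativeRing K hiding (zero)
  open Power K
  open PrimitiveRoot K isField prim
  open FieldPolynomial K isField using (Distinct)
  open import Relation.Binary.Reasoning.Setoid setoid
  open import Data.Nat.Solver using (module +-*-Solver)
  open +-*-Solver using (solve; _:=_; _:+_; _:*_)

  instance
    m≢0 : NonZero m
    m≢0 = ℕ.>-nonZero (proj₁ prim)

  roots : List Carrier
  roots = map (ζ ^_) L

  prodₚ-linear-pow≡linearProduct : prodₚ K (map (λ η → linear K (pow K ζ η)) L) ≡ Polynomial.linearProduct K roots
  prodₚ-linear-pow≡linearProduct = ≡.cong (prodₚ K)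
    (≡.trans (map-cong (λ η → ≡.cong (linear K) (pow≡^ ζ η)) L) (map-∘ L))

  roots-distinct : Distinct roots
  roots-distinct = distinct-powers unique (All.tabulate λ {η} η∈L → proj₁ (proj₁ (coset η) η∈L))

  ζᵞ∈roots : ζ ^ γ ∈ roots
  ζᵞ∈roots = ∈-map⁺ (ζ ^_) (proj₂ (coset γ) (γ<m , 0 , 0 , γ*1≡γ+0))
    where
    γ*1≡γ+0 : γ ℕ.* 1 ≡ γ ℕ.+ 0
    γ*1≡γ+0 = ≡.trans (ℕ.*-identityʳ γ) (≡.sym (ℕ.+-identityʳ γ))

  coset-power : ∀ i η t → γ ℕ.* q ℕ.^ i ≡ η ℕ.+ t ℕ.* m → ∀ k → (ζ ^ η) ^ k ≈ (ζ ^ (γ ℕ.* k)) ^ (q ℕ.^ i)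
  coset-power i η t γqⁱ≡η+tm k = begin
    (ζ ^ η) ^ k                            ≈⟨ ^-assocʳ ζ η k ⟩
    ζ ^ (η ℕ.* k)                          ≈⟨ ^-periodic ζᵐ≈1 (η ℕ.* k) (t ℕ.* k) ⟨
    ζ ^ (η ℕ.* k ℕ.+ t ℕ.* k ℕ.* m)        ≡⟨ ≡.cong (ζ ^_) exponent ⟩
    ζ ^ (γ ℕ.* k ℕ.* q ℕ.^ i)              ≈⟨ ^-assocʳ ζ (γ ℕ.* k) (q ℕ.^ i) ⟨
    (ζ ^ (γ ℕ.* k)) ^ (q ℕ.^ i)            ∎
    where
    exponent : η ℕ.* k ℕ.+ t ℕ.* k ℕ.* m ≡ γ ℕ.* k ℕ.* q ℕ.^ i
    exponent = ≡.trans (solve 4 (λ η k t m → η :* k :+ t :* k :* m := (η :+ t :* m) :* k) ≡.refl η k t m)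
                 (≡.trans (≡.cong (ℕ._* k) (≡.sym γqⁱ≡η+tm))
                   (solve 3 (λ γ Q k → γ :* Q :* k := γ :* k :* Q) ≡.refl γ (q ℕ.^ i) k))

  roots^-if-fixed : ∀ k → (ζ ^ (γ ℕ.* k)) ^ q ≈ ζ ^ (γ ℕ.* k) → ∀ {r} → r ∈ roots → r ^ k ≈ ζ ^ (γ ℕ.* k)
  roots^-if-fixed k fixed r∈roots with ∈-map⁻ (ζ ^_) r∈roots
  ... | η , η∈L , ≡.refl with proj₁ (coset η) η∈L
  ... | _ , i , t , γqⁱ≡η+tm = trans (coset-power i η t γqⁱ≡η+tm k) (^-iterate-fixed fixed i)

  -- x ↦ x ^ q maps the root ζ ^ γ to the root ζ ^ (γ q mod m).
  roots^≈⇒fixed : ∀ k {w} → (∀ {r} → r ∈ roots → r ^ k ≈ w) → w ^ q ≈ w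
  roots^≈⇒fixed k {w} rᵏ≈w = begin
    w ^ q                          ≈⟨ ^-congˡ q (rᵏ≈w ζᵞ∈roots) ⟨
    ((ζ ^ γ) ^ k) ^ q              ≈⟨ ^-congˡ q (^-assocʳ ζ γ k) ⟩
    (ζ ^ (γ ℕ.* k)) ^ q            ≡⟨ ≡.cong (_ ^_) (ℕ.*-identityʳ q) ⟨
    (ζ ^ (γ ℕ.* k)) ^ (q ℕ.^ 1)    ≈⟨ coset-power 1 η t γq≡η+tm k ⟨
    (ζ ^ η) ^ k                    ≈⟨ rᵏ≈w (∈-map⁺ (ζ ^_) η∈L) ⟩
    w                              ∎
    where
    γq : ℕ
    γq = γ ℕ.* q ℕ.^ 1
    η : ℕ
    η = γq % m
    t : ℕ
    t = γq / m
    γq≡η+tm : γq ≡ η ℕ.+ t ℕ.* m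
    γq≡η+tm = m≡m%n+[m/n]*n γq m
    η∈L : η ∈ L
    η∈L = proj₂ (coset η) (m%n<n γq m , 1 , t , γq≡η+tm)

module _ {c ℓ} (F : CommutativeRing c ℓ) where
  open CommutativeRing F

  HasCardinality⇒Decidable : ∀ {q} → HasCardinality F q → Decidable _≈_
  HasCardinality⇒Decidable (e , e-injective , e-surjective) x y
    with e-surjective x | e-surjective y
  ... | i , eᵢ≈x | j , eⱼ≈y with i Fin.≟ j
  ... | yes ≡.refl = yes (trans (sym eᵢ≈x) eⱼ≈y)
  ... | no  i≢j    = no (λ x≈y → i≢j (e-injective i j (trans eᵢ≈x (trans x≈y (sym eⱼ≈y)))))

  HasCardinality⇒≡suc : ∀ {q} → HasCardinality F q → q ≡ suc (q ∸ 1)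
  HasCardinality⇒≡suc {suc q} _                   = ≡.refl
  HasCardinality⇒≡suc {zero}  (_ , _ , e-surjective) with e-surjective 0#
  ... | () , _

open import Data.Nat using (_*_)

module GcdCofactor (m p n : ℕ) (0<m : 0 < m) (n*d≡m : n * gcd m p ≡ m) where

  private
    d : ℕ
    d = gcd m p

    instance
      d≢0 : NonZero d
      d≢0 = ℕ.≢-nonZero (gcd[m,n]≢0 m p (inj₁ (ℕ.≢-nonZero⁻¹ m {{ℕ.>-nonZero 0<m}})))

    s : ℕ
    s = quotient (gcd[m,n]∣n m p)

    p≡s*d : p ≡ s * d
    p≡s*d = _∣_.equality (gcd[m,n]∣n m p)

  cofactor>0 : 0 < n
  cofactor>0 = ℕ.>-nonZero⁻¹ n {{ℕ.m*n≢0⇒m≢0 n {{ℕ.>-nonZero (≡.subst (0 <_) (≡.sym n*d≡m) 0<m)}}}}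

  exponent-cofactor : ∀ e γ → e * d ≡ γ * m → e ≡ γ * n
  exponent-cofactor e γ e*d≡γ*m = ℕ.*-cancelʳ-≡ e (γ * n) d (begin
    e * d        ≡⟨ e*d≡γ*m ⟩
    γ * m        ≡⟨ ≡.cong (γ *_) n*d≡m ⟨
    γ * (n * d)  ≡⟨ ℕ.*-assoc γ n d ⟨
    γ * n * d    ∎)
    where open ≡.≡-Reasoning

  m∣n*p : m ∣ n * p
  m∣n*p = ≡.subst (_∣ n * p) n*d≡m (*-monoʳ-∣ n (gcd[m,n]∣n m p))

  m∣*p⇒n∣ : ∀ {n′} → m ∣ n′ * p → n ∣ n′
  m∣*p⇒n∣ {n′} m∣n′p =
    coprime-divisor n⊥s (*-cancelʳ-∣ d (≡.subst₂ _∣_ (≡.sym n*d≡m) n′*p≡s*n′*d m∣n′p))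
    where
    n′*p≡s*n′*d : n′ * p ≡ s * n′ * d
    n′*p≡s*n′*d = ≡.trans (≡.cong (n′ *_) p≡s*d)
                    (≡.trans (≡.sym (ℕ.*-assoc n′ s d)) (≡.cong (_* d) (ℕ.*-comm n′ s)))

    n⊥s : Coprimality.Coprime n s
    n⊥s = ≡.subst₂ Coprimality.Coprime (cancel n*d≡m) (cancel (≡.sym p≡s*d)) (coprime-/gcd m p)
      where
      cancel : ∀ {x y} → x * d ≡ y → y / d ≡ x
      cancel {x} ≡.refl = m*n/n≡m x d

module MinimalBinomialMultiple
  {c ℓ c′ ℓ′} (F : CommutativeRing c ℓ) (isFieldF : IsField F) (q : ℕ) (card : HasCardinality F q)
  (K : CommutativeRing c′ ℓ′) (isFieldK : IsField K)
  (ι : CommutativeRing.Carrier F → CommutativeRing.Carrier K) (hom : IsRingHom F K ι)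
  (f : Poly F) (m : ℕ) (ord : HasOrder F f m)
  (ζ : CommutativeRing.Carrier K) (prim : IsPrimitiveRoot K m ζ) (γ : ℕ) (γ<m : γ < m)
  (a : CommutativeRing.Carrier F) (a≉0 : ¬ (CommutativeRing._≈_ F a (CommutativeRing.0# F)))
  (L : List ℕ) (unique : Unique L)
  (coset : ∀ η → (η ∈ L → InCyclotomicCoset m q γ η) × (InCyclotomicCoset m q γ η → η ∈ L))
  (split : _≈ₚ_ K (mapPoly F K ι f) (_*ₚ_ K (const K (ι a)) (prodₚ K (map (λ η → linear K (pow K ζ η)) L))))
  (n : ℕ) (n*d≡m : n * gcd m (q ∸ 1) ≡ m) where

  private
    module F = CommutativeRing F
    module K = CommutativeRing K
  open Power K using (_^_; ^-congˡ; ^-assocʳ)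
  open GcdCofactor m (q ∸ 1) n (proj₁ ord) n*d≡m using (m∣n*p; m∣*p⇒n∣)
  open PrimitiveRoot K isFieldK prim using (ζ^-frobenius-fixed; ζ^≉0)
  open CyclotomicCoset K isFieldK prim γ<m unique coset
  open FieldHomomorphism F isFieldF K isFieldK ι hom using (ι-≉0)
  open FieldPolynomial K isFieldK using (^-suc≈⇒^≈1)
  open SplitPolynomial F isFieldF (HasCardinality⇒Decidable F card) K isFieldK ι hom f a a≉0 roots
         (∈-length ζᵞ∈roots) roots-distinct
         (≡.subst (λ P → _≈ₚ_ K (mapPoly F K ι f) (_*ₚ_ K (const K (ι a)) P)) prodₚ-linear-pow≡linearProduct split)
  open RingMorphisms.IsRingHomomorphism hom using (⟦⟧-cong; 0#-homo)

  private
    p : ℕ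
    p = q ∸ 1

    q≡1+p : q ≡ suc p
    q≡1+p = HasCardinality⇒≡suc F card

  ζᵞⁿ-fixed : (ζ ^ (γ * n)) ^ q K.≈ ζ ^ (γ * n)
  ζᵞⁿ-fixed = ≡.subst (λ q → (ζ ^ (γ * n)) ^ q K.≈ ζ ^ (γ * n)) (≡.sym q≡1+p)
    (ζ^-frobenius-fixed (γ * n) p (≡.subst (m ∣_) (≡.sym (ℕ.*-assoc γ n p)) (∣n⇒∣m*n γ m∣n*p)))

  binomial-multiple : ∃ λ μ → ι μ K.≈ ζ ^ (γ * n) × _∣ₚ_ F f (binomial F n μ)
  binomial-multiple = roots^≈⇒∣binomial n (ζ ^ (γ * n)) (roots^-if-fixed n ζᵞⁿ-fixed)

  binomial-constant-≉0 : ∀ {μ} → ι μ K.≈ ζ ^ (γ * n) → ¬ μ F.≈ F.0#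
  binomial-constant-≉0 ιμ≈ζᵞⁿ μ≈0 = ζ^≉0 (γ * n) (K.trans (K.sym ιμ≈ζᵞⁿ) (K.trans (⟦⟧-cong μ≈0) 0#-homo))

  binomial-multiple-minimal : ∀ n′ μ′ → 1 ≤ n′ → ¬ μ′ F.≈ F.0# → _∣ₚ_ F f (binomial F n′ μ′) → n ≤ n′
  binomial-multiple-minimal n′ μ′ 1≤n′ μ′≉0 f∣ =
    ∣⇒≤ {{ℕ.>-nonZero 1≤n′}} (m∣*p⇒n∣ (roots^≈1⇒order∣ ord rⁿ′ᵖ≈1))
    where
    rⁿ′≈ιμ′ : ∀ {r} → r ∈ roots → r ^ n′ K.≈ ι μ′
    rⁿ′≈ιμ′ = ∣binomial⇒roots^≈ n′ μ′ f∣

    ιμ′ᵖ≈1 : ι μ′ ^ p K.≈ K.1#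
    ιμ′ᵖ≈1 = ^-suc≈⇒^≈1 (ι μ′) p (ι-≉0 μ′≉0)
      (≡.subst (λ q → ι μ′ ^ q K.≈ ι μ′) q≡1+p (roots^≈⇒fixed n′ rⁿ′≈ιμ′))

    rⁿ′ᵖ≈1 : ∀ {r} → r ∈ roots → r ^ (n′ * p) K.≈ K.1#
    rⁿ′ᵖ≈1 {r} r∈roots =
      K.trans (K.sym (^-assocʳ r n′ p)) (K.trans (^-congˡ p (rⁿ′≈ιμ′ r∈roots)) ιμ′ᵖ≈1)

lemma7 : ∀ {c ℓ c′ ℓ′}
    (F : CommutativeRing c ℓ) → IsField F →
    (q : ℕ) → HasCardinality F q →
    (K : CommutativeRing c′ ℓ′) → IsField K →
    (ι : CommutativeRing.Carrier F → CommutativeRing.Carrier K) → IsRingHom F K ι →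
    (f : Poly F) → Irreducible F f → Coprime F f (X F) →
    (m : ℕ) → HasOrder F f m →
    (ζ : CommutativeRing.Carrier K) → IsPrimitiveRoot K m ζ →
    (γ : ℕ) → γ < m →
    (a : CommutativeRing.Carrier F) → ¬ (CommutativeRing._≈_ F a (CommutativeRing.0# F)) →
    (L : List ℕ) → Unique L →
    (∀ η → (η ∈ L → InCyclotomicCoset m q γ η) × (InCyclotomicCoset m q γ η → η ∈ L)) →
    _≈ₚ_ K (mapPoly F K ι f)
      (_*ₚ_ K (const K (ι a)) (prodₚ K (map (λ η → linear K (pow K ζ η)) L))) →
    (n e : ℕ) → n * gcd m (q ∸ 1) ≡ m → e * gcd m (q ∸ 1) ≡ γ * m →
    ∃ λ μ → CommutativeRing._≈_ K (ι μ) (pow K ζ e) × IsMinimalBinomialMultiple F f n μ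
lemma7 F isFieldF q card K isFieldK ι hom f _ _ m ord ζ prim γ γ<m a a≉0 L unique coset split n e n*d≡m e*d≡γm =
  let μ , ιμ≈ζᵞⁿ , f∣xⁿ-μ = binomial-multiple
  in  μ , K.trans ιμ≈ζᵞⁿ ζᵞⁿ≈ζᵉ , cofactor>0 , binomial-constant-≉0 ιμ≈ζᵞⁿ , f∣xⁿ-μ , binomial-multiple-minimal
  where
  module K = CommutativeRing K
  open Power K using (_^_; pow≡^)
  open GcdCofactor m (q ∸ 1) n (proj₁ ord) n*d≡m using (cofactor>0; exponent-cofactor)
  open MinimalBinomialMultiple F isFieldF q card K isFieldK ι hom f m ord ζ prim γ γ<m a a≉0 L unique coset split
         n n*d≡m

  ζᵞⁿ≈ζᵉ : ζ ^ (γ * n) K.≈ pow K ζ e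
  ζᵞⁿ≈ζᵉ = K.reflexive
    (≡.trans (≡.cong (ζ ^_) (≡.sym (exponent-cofactor e γ e*d≡γm))) (≡.sym (pow≡^ ζ e)))
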